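{- Let $\phi=\frac{\sqrt5+1}{2}$. (i) For the paths $P_n$ (vertex set $\{1,\ldots,n\}$, edges $(1,2),\ldots,(n-1,n)$), $\lim_{n\to\infty} f_{11}/f=\phi^{ -1}$. (ii) For the graphs $T_n$ (vertex set $\{1,\ldots,n\}$, edges $(1,3),(2,3),(3,4),\ldots,(n-1,n)$), $\lim_{n\to\infty} f_{nn}/f=\phi^{ -1}$ and $\lim_{n\to\infty} f_{33}/f=1-\phi^{ -1}$.
   Context: A spanning rooted forest of a graph is a spanning acyclic subgraph in which exactly one vertex (the root) is marked in each tree. For a graph, $f_{ii}$ is the number of its spanning rooted forests in which vertex $i$ is a root and $f$ is its total number of spanning rooted forests. -}

module Defs where

open import Data.Bool using (Bool; true; false; if_then_else_; _∧_)
open import Data.Nat as ℕ using (ℕ; zero; suc; _≡ᵇ_)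
open import Data.Fin using (Fin; zero; suc; toℕ; fromℕ; _↑ʳ_) renaming (_≟_ to _≟ᶠ_)
open import Data.List using (List; []; _∷_; map; length; filterᵇ; cartesianProduct; allFin; _++_)
open import Data.Bool.ListAction using (any; all)
open import Data.Maybe using (Maybe; just; nothing)
open import Data.Product using (_×_; _,_; proj₁; proj₂; ∃-syntax)
open import Data.Sum using (_⊎_)
open import Data.Integer using (+_)
open import Data.Rational using (ℚ; _/_; _<_; _+_; _-_; _*_; 0ℚ; 1ℚ)
open import Relation.Nullary.Decidable using (⌊_⌋)

Edges : ℕ → Set
Edges n = List (Fin n × Fin n)

sublists : {A : Set} → List A → List (List A)
sublists []       = [] ∷ []
sublists (x ∷ xs) = let s = sublists xs in s ++ map (x ∷_) s

-- Starting with label(v) = v, each edge (u , v) merges the two label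
-- classes; if its endpoints already have the same label, the edge closes
-- a cycle and we return nothing.  So  components F = just L  iff  F is
-- acyclic (a forest), and then L u = L v iff u,v are in the same tree.

mergeEdges : {n : ℕ} → (Fin n → ℕ) → Edges n → Maybe (Fin n → ℕ)
mergeEdges L [] = just L
mergeEdges L ((u , v) ∷ es) =
  if L u ≡ᵇ L v then nothing
  else mergeEdges (λ w → if L w ≡ᵇ L v then L u else L w) es

components : {n : ℕ} → Edges n → Maybe (Fin n → ℕ)
components F = mergeEdges toℕ F

isRootedForest : {n : ℕ} → Edges n → List (Fin n) → Bool
isRootedForest {n} F R with components F
... | nothing = false
... | just L  = all (λ v → length (filterᵇ (λ r → L r ≡ᵇ L v) R) ≡ᵇ 1) (allFin n)

candidates : {n : ℕ} → Edges n → List (Edges n × List (Fin n))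
candidates {n} E = cartesianProduct (sublists E) (sublists (allFin n))

f : {n : ℕ} → Edges n → ℕ
f E = length (filterᵇ (λ p → isRootedForest (proj₁ p) (proj₂ p)) (candidates E))

fii : {n : ℕ} → Edges n → Fin n → ℕ
fii E i = length (filterᵇ (λ p → isRootedForest (proj₁ p) (proj₂ p)
                                  ∧ any (λ r → ⌊ r ≟ᶠ i ⌋) (proj₂ p))
                          (candidates E))

-- The graphs.  Paper vertex k corresponds to Fin index k - 1.

pathEdges : (n : ℕ) → Edges n
pathEdges zero                = []
pathEdges (suc zero)          = []
pathEdges (suc (suc n))       = (zero , suc zero) ∷ map (λ e → suc (proj₁ e) , suc (proj₂ e)) (pathEdges (suc n))

-- T_{k+3} : edges (1,3),(2,3),(3,4),…,(k+2,k+3)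
TEdges : (k : ℕ) → Edges (suc (suc (suc k)))
TEdges k = (zero , suc (suc zero)) ∷ (suc zero , suc (suc zero))
         ∷ map (λ e → 2 ↑ʳ proj₁ e , 2 ↑ʳ proj₂ e) (pathEdges (suc k))

-- p / q as a rational (q = 0 never occurs below since f ≥ 1)
frac : ℕ → ℕ → ℚ
frac p zero    = 0ℚ
frac p (suc q) = (+ p) / suc q

-- q < φ⁻¹   (φ⁻¹ is the positive root of x² + x = 1)
_<φ⁻¹ : ℚ → Set
q <φ⁻¹ = (q < 0ℚ) ⊎ (q * q + q < 1ℚ)

φ⁻¹<_ : ℚ → Set
φ⁻¹< q = (0ℚ < q) × (1ℚ < q * q + q)

LimIsInvφ : (ℕ → ℚ) → Set
LimIsInvφ r = ∀ (ε : ℚ) → 0ℚ < ε → ∃[ N ] ∀ n → N ℕ.≤ n →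
  ((r n - ε) <φ⁻¹) × (φ⁻¹< (r n + ε))

-- lim_{n→∞} r n = 1 - φ⁻¹ :  r n - ε < 1 - φ⁻¹ < r n + ε,
-- i.e. φ⁻¹ < 1 - (r n - ε)  and  1 - (r n + ε) < φ⁻¹.
LimIsOneMinusInvφ : (ℕ → ℚ) → Set
LimIsOneMinusInvφ r = ∀ (ε : ℚ) → 0ℚ < ε → ∃[ N ] ∀ n → N ℕ.≤ n →
  (φ⁻¹< (1ℚ - (r n - ε))) × ((1ℚ - (r n + ε)) <φ⁻¹)

{-# OPTIONS --safe #-}
-- Attach a new vertex 0 to a vertex j of a graph E.  In a spanning rooted forest of
-- the new graph either the edge (0 , j) is absent, and 0 is an isolated tree which must
-- be its own root, or 0 lies in the tree of j, either as a non-root or as the root of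
-- that tree, whose trace on E then has no root.  Counting also the forests in which one
-- prescribed tree is rootless, this gives linear recurrences.  For the path, f and f₁₁
-- are the Fibonacci numbers F₂ₙ₊₂ and F₂ₙ₊₁, and Cassini's identity reads
-- f₁₁² + f₁₁ f = f² + 1, so x = f₁₁ / f satisfies x² + x = 1 + 1 / f².  T_n is the path
-- 2 – 3 – ⋯ – n with the pendant vertex 1 attached at 3; its counts f, f_nn, f₃₃ are
-- 4(F + G), 4F, 4G for the counts F = f, G = f₁₁ of the path 3 – ⋯ – n, and
-- x = f_nn / f satisfies x² + x = 1 - 16 / f².  Since y ↦ y² + y increases with slope at
-- least 1 on y ≥ 0, such an x lies within 16 / f² of the positive root φ⁻¹ of y² + y = 1.
module Submission where

open import Defs
open import Data.Nat using (ℕ; suc; zero)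
open import Data.Fin using (Fin; zero; suc; fromℕ)
open import Data.Product using (_×_; _,_)

module RootedForests where

  open import Data.Bool using (Bool; true; false; if_then_else_; _∧_; _∨_; T)
  open import Data.Bool.Properties using (∧-zeroʳ; ∧-identityʳ)
  open import Data.Bool.ListAction using (all; any; and)
  open import Data.Fin using (toℕ; _≟_)
  open import Data.Fin.Properties using (suc-injective)
  open import Data.List using (List; []; _∷_; _++_; map; length; filterᵇ; allFin; cartesianProduct)
  open import Data.List.Properties using (map-++; map-∘; map-cong; map-tabulate; cartesianProductWith-distribʳ-++)
  open import Data.Maybe using (Maybe; just; nothing; maybe′)
  import Data.Maybe as Maybe
  open import Data.Maybe.Relation.Binary.Pointwise using (Pointwise; just; nothing)
  open import Data.Nat using (_+_; _*_; _≤_; _<_; _≡ᵇ_; z≤n; s≤s)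
  import Data.Nat as ℕ
  open import Data.Nat.Properties
    using ( ≡ᵇ⇒≡; +-assoc; +-identityʳ; +-comm; +-cancelʳ-≡; +-commutativeSemigroup
          ; ≤-trans; m≤m+n; m≤n+m; m<m+n; m≤n*m )
  open import Algebra.Properties.CommutativeSemigroup +-commutativeSemigroup using (interchange)
  open import Data.Nat.Tactic.RingSolver using (solve-∀)
  open import Data.Product using (_,_; uncurry)
  import Data.Product as Product
  open import Function using (_∘_; id)
  open import Function.Bundles using (mk⇔)
  open import Relation.Binary.PropositionalEquality
  open import Relation.Nullary.Decidable using (⌊_⌋; dec-true; does-⇔; ⌊⌋-map′)

  private
    variable
      m n : ℕ

  count : {A : Set} → (A → Bool) → List A → ℕ
  count p xs = length (filterᵇ p xs)

  module _ {A : Set} where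

    count-++ : (p : A → Bool) (xs ys : List A) → count p (xs ++ ys) ≡ count p xs + count p ys
    count-++ p []       ys = refl
    count-++ p (x ∷ xs) ys with p x
    ... | true  = cong suc (count-++ p xs ys)
    ... | false = count-++ p xs ys

    count-cong : {p q : A → Bool} → (∀ x → p x ≡ q x) → (xs : List A) → count p xs ≡ count q xs
    count-cong p≗q []       = refl
    count-cong {p} {q} p≗q (x ∷ xs) with p x | q x | p≗q x
    ... | true  | true  | refl = cong suc (count-cong p≗q xs)
    ... | false | false | refl = count-cong p≗q xs

    count-∷-true : {p : A → Bool} {x : A} → p x ≡ true → (xs : List A) → count p (x ∷ xs) ≡ suc (count p xs)
    count-∷-true px xs rewrite px = refl

    count-∷-false : {p : A → Bool} {x : A} → p x ≡ false → (xs : List A) → count p (x ∷ xs) ≡ count p xs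
    count-∷-false px xs rewrite px = refl

    count-false : (xs : List A) → count (λ _ → false) xs ≡ 0
    count-false []       = refl
    count-false (x ∷ xs) = count-false xs

  count-map : {A B : Set} (p : B → Bool) (g : A → B) (xs : List A) → count p (map g xs) ≡ count (p ∘ g) xs
  count-map p g []       = refl
  count-map p g (x ∷ xs) with p (g x)
  ... | true  = cong suc (count-map p g xs)
  ... | false = count-map p g xs

  module _ {A B : Set} (P : A × B → Bool) where

    count-cartesianProduct-++ʳ : (xs : List A) (ys zs : List B) →
      count P (cartesianProduct xs (ys ++ zs)) ≡ count P (cartesianProduct xs ys) + count P (cartesianProduct xs zs)
    count-cartesianProduct-++ʳ []       ys zs = refl
    count-cartesianProduct-++ʳ (x ∷ xs) ys zs = begin
      count P (map (x ,_) (ys ++ zs) ++ cartesianProduct xs (ys ++ zs))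
        ≡⟨ count-++ P (map (x ,_) (ys ++ zs)) _ ⟩
      count P (map (x ,_) (ys ++ zs)) + count P (cartesianProduct xs (ys ++ zs))
        ≡⟨ cong₂ _+_ (trans (cong (count P) (map-++ (x ,_) ys zs)) (count-++ P (map (x ,_) ys) _))
                     (count-cartesianProduct-++ʳ xs ys zs) ⟩
      (count P (map (x ,_) ys) + count P (map (x ,_) zs))
        + (count P (cartesianProduct xs ys) + count P (cartesianProduct xs zs))
        ≡⟨ interchange (count P (map (x ,_) ys)) (count P (map (x ,_) zs)) _ _ ⟩
      (count P (map (x ,_) ys) + count P (cartesianProduct xs ys))
        + (count P (map (x ,_) zs) + count P (cartesianProduct xs zs))
        ≡⟨ sym (cong₂ _+_ (count-++ P (map (x ,_) ys) _) (count-++ P (map (x ,_) zs) _)) ⟩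
      count P (cartesianProduct (x ∷ xs) ys) + count P (cartesianProduct (x ∷ xs) zs) ∎
      where open ≡-Reasoning

    count-cartesianProduct-++ : (xs xs′ : List A) (ys ys′ : List B) →
      count P (cartesianProduct (xs ++ xs′) (ys ++ ys′))
        ≡ (count P (cartesianProduct xs ys) + count P (cartesianProduct xs ys′))
          + (count P (cartesianProduct xs′ ys) + count P (cartesianProduct xs′ ys′))
    count-cartesianProduct-++ xs xs′ ys ys′ = begin
      count P (cartesianProduct (xs ++ xs′) (ys ++ ys′))
        ≡⟨ cong (count P) (cartesianProductWith-distribʳ-++ _,_ xs xs′ (ys ++ ys′)) ⟩
      count P (cartesianProduct xs (ys ++ ys′) ++ cartesianProduct xs′ (ys ++ ys′))
        ≡⟨ count-++ P (cartesianProduct xs (ys ++ ys′)) _ ⟩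
      count P (cartesianProduct xs (ys ++ ys′)) + count P (cartesianProduct xs′ (ys ++ ys′))
        ≡⟨ cong₂ _+_ (count-cartesianProduct-++ʳ xs ys ys′) (count-cartesianProduct-++ʳ xs′ ys ys′) ⟩
      _ ∎
      where open ≡-Reasoning

  cartesianProduct-map : {A B C D : Set} (g : A → C) (h : B → D) (xs : List A) (ys : List B) →
    cartesianProduct (map g xs) (map h ys) ≡ map (Product.map g h) (cartesianProduct xs ys)
  cartesianProduct-map g h []       ys = refl
  cartesianProduct-map g h (x ∷ xs) ys = begin
    map (g x ,_) (map h ys) ++ cartesianProduct (map g xs) (map h ys)
      ≡⟨ cong₂ _++_ (sym (map-∘ ys)) (cartesianProduct-map g h xs ys) ⟩
    map ((g x ,_) ∘ h) ys ++ map (Product.map g h) (cartesianProduct xs ys)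
      ≡⟨ cong (_++ _) (map-∘ ys) ⟩
    map (Product.map g h) (map (x ,_) ys) ++ map (Product.map g h) (cartesianProduct xs ys)
      ≡⟨ sym (map-++ (Product.map g h) (map (x ,_) ys) _) ⟩
    map (Product.map g h) (cartesianProduct (x ∷ xs) ys) ∎
    where open ≡-Reasoning

  sublists-map : {A B : Set} (g : A → B) (xs : List A) → sublists (map g xs) ≡ map (map g) (sublists xs)
  sublists-map g []       = refl
  sublists-map g (x ∷ xs) = begin
    sublists (map g xs) ++ map (g x ∷_) (sublists (map g xs))
      ≡⟨ cong (λ s → s ++ map (g x ∷_) s) (sublists-map g xs) ⟩
    map (map g) (sublists xs) ++ map (g x ∷_) (map (map g) (sublists xs))
      ≡⟨ cong (map (map g) (sublists xs) ++_) (sym (map-∘ (sublists xs))) ⟩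
    map (map g) (sublists xs) ++ map (map g ∘ (x ∷_)) (sublists xs)
      ≡⟨ cong (map (map g) (sublists xs) ++_) (map-∘ (sublists xs)) ⟩
    map (map g) (sublists xs) ++ map (map g) (map (x ∷_) (sublists xs))
      ≡⟨ sym (map-++ (map g) (sublists xs) _) ⟩
    map (map g) (sublists (x ∷ xs)) ∎
    where open ≡-Reasoning

  sublists-∷-map : {A B : Set} (x : B) (g : A → B) (xs : List A) →
    sublists (x ∷ map g xs) ≡ map (map g) (sublists xs) ++ map ((x ∷_) ∘ map g) (sublists xs)
  sublists-∷-map x g xs = trans (cong (λ s → s ++ map (x ∷_) s) (sublists-map g xs))
                                (cong (map (map g) (sublists xs) ++_) (sym (map-∘ (sublists xs))))

  allFin-suc : ∀ m → allFin (suc m) ≡ zero ∷ map suc (allFin m)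
  allFin-suc m = cong (zero ∷_) (sym (map-tabulate id suc))

  count-cartesianProduct-map : {A B C D : Set} (P : C × D → Bool) (g : A → C) (h : B → D) (xs : List A) (ys : List B) →
    count P (cartesianProduct (map g xs) (map h ys)) ≡ count (P ∘ Product.map g h) (cartesianProduct xs ys)
  count-cartesianProduct-map P g h xs ys =
    trans (cong (count P) (cartesianProduct-map g h xs ys)) (count-map P (Product.map g h) (cartesianProduct xs ys))

  shift : Fin m × Fin m → Fin (suc m) × Fin (suc m)
  shift = Product.map suc suc

  pendant : Fin m → Edges m → Edges (suc m)
  pendant j E = (zero , suc j) ∷ map shift E

  countCandidates : Edges n → (Edges n → List (Fin n) → Bool) → ℕ
  countCandidates E P = count (uncurry P) (candidates E)

  countCandidates-pendant : (j : Fin m) (E : Edges m) (P : Edges (suc m) → List (Fin (suc m)) → Bool) →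
    countCandidates (pendant j E) P ≡
        (countCandidates E (λ F R → P (map shift F) (map suc R))
         + countCandidates E (λ F R → P (map shift F) (zero ∷ map suc R)))
      + (countCandidates E (λ F R → P (pendant j F) (map suc R))
         + countCandidates E (λ F R → P (pendant j F) (zero ∷ map suc R)))
  countCandidates-pendant {m} j E P = begin
    count (uncurry P) (cartesianProduct (sublists (pendant j E)) (sublists (allFin (suc m))))
      ≡⟨ cong₂ (λ xs ys → count (uncurry P) (cartesianProduct xs ys))
               (sublists-∷-map (zero , suc j) shift E)
               (trans (cong sublists (allFin-suc m)) (sublists-∷-map zero suc (allFin m))) ⟩
    count (uncurry P) (cartesianProduct (map (map shift) X ++ map (pendant j) X)
                                        (map (map suc) Y ++ map ((zero ∷_) ∘ map suc) Y))
      ≡⟨ count-cartesianProduct-++ (uncurry P) (map (map shift) X) _ (map (map suc) Y) _ ⟩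
    _ ≡⟨ cong₂ _+_ (cong₂ _+_ (block (map shift) (map suc)) (block (map shift) ((zero ∷_) ∘ map suc)))
                   (cong₂ _+_ (block (pendant j) (map suc)) (block (pendant j) ((zero ∷_) ∘ map suc))) ⟩
    _ ∎
    where
    open ≡-Reasoning
    X = sublists E
    Y = sublists (allFin m)
    block : (g : Edges m → Edges (suc m)) (h : List (Fin m) → List (Fin (suc m))) →
      count (uncurry P) (cartesianProduct (map g X) (map h Y)) ≡ countCandidates E (λ F R → P (g F) (h R))
    block g h = count-cartesianProduct-map (uncurry P) g h X Y

  -- allRooted: every tree has exactly one root.  unrootedAt j: the same, except that
  -- the tree containing j has no root.
  data Quota (n : ℕ) : Set where
    allRooted  : Quota n
    unrootedAt : Fin n → Quota n

  rootCount : (Fin n → ℕ) → List (Fin n) → ℕ → ℕ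
  rootCount L R x = count (λ r → L r ≡ᵇ x) R

  required : Quota n → (Fin n → ℕ) → ℕ → ℕ
  required allRooted      L x = 1
  required (unrootedAt j) L x = if x ≡ᵇ L j then 0 else 1

  meetsQuotaAt : Quota n → (Fin n → ℕ) → List (Fin n) → Fin n → Bool
  meetsQuotaAt q L R v = rootCount L R (L v) ≡ᵇ required q L (L v)

  meetsQuota : Quota n → (Fin n → ℕ) → List (Fin n) → Bool
  meetsQuota {n} q L R = all (meetsQuotaAt q L R) (allFin n)

  isForestWith : Quota n → Edges n → List (Fin n) → Bool
  isForestWith q F R = maybe′ (λ L → meetsQuota q L R) false (components F)

  hasRoot : Maybe (Fin n) → List (Fin n) → Bool
  hasRoot nothing  R = true
  hasRoot (just i) R = any (λ r → ⌊ r ≟ i ⌋) R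

  forestCount : Edges n → Quota n → Maybe (Fin n) → ℕ
  forestCount E q i = countCandidates E (λ F R → isForestWith q F R ∧ hasRoot i R)

  isRootedForest-allRooted : (F : Edges n) (R : List (Fin n)) → isRootedForest F R ≡ isForestWith allRooted F R
  isRootedForest-allRooted F R with components F
  ... | nothing = refl
  ... | just L  = refl

  f≡forestCount : (E : Edges n) → f E ≡ forestCount E allRooted nothing
  f≡forestCount E = count-cong (λ (F , R) → trans (isRootedForest-allRooted F R) (sym (∧-identityʳ _))) (candidates E)

  fii≡forestCount : (E : Edges n) (i : Fin n) → fii E i ≡ forestCount E allRooted (just i)
  fii≡forestCount E i = count-cong (λ (F , R) → cong (_∧ hasRoot (just i) R) (isRootedForest-allRooted F R)) (candidates E)

  ≡ᵇ-refl : ∀ x → (x ≡ᵇ x) ≡ true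
  ≡ᵇ-refl x = dec-true (x ℕ.≟ x) refl

  ≡ᵇ-sym : ∀ x y → (x ≡ᵇ y) ≡ (y ≡ᵇ x)
  ≡ᵇ-sym x y = does-⇔ (mk⇔ sym sym) (x ℕ.≟ y) (y ℕ.≟ x)

  ≡ᵇ-true⇒≡ : ∀ x y → (x ≡ᵇ y) ≡ true → x ≡ y
  ≡ᵇ-true⇒≡ x y e = ≡ᵇ⇒≡ x y (subst T (sym e) _)

  relabel : (Fin n → ℕ) → Fin n → Fin n → Fin n → ℕ
  relabel L u v w = if L w ≡ᵇ L v then L u else L w

  EqᵇInjective : (ℕ → ℕ) → Set
  EqᵇInjective h = ∀ x y → (h x ≡ᵇ h y) ≡ (x ≡ᵇ y)

  LiftsVia : (ℕ → ℕ) → (Fin (suc m) → ℕ) → (Fin m → ℕ) → Set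
  LiftsVia h L L′ = ∀ w → L (suc w) ≡ h (L′ w)

  relabel-lifts : ∀ {h} → EqᵇInjective h → {L : Fin (suc m) → ℕ} {L′ : Fin m → ℕ} →
    LiftsVia h L L′ → ∀ a b → LiftsVia h (relabel L (suc a) (suc b)) (relabel L′ a b)
  relabel-lifts h-inj {L} {L′} lift a b w
    rewrite lift w | lift b | lift a | h-inj (L′ w) (L′ b) with L′ w ≡ᵇ L′ b
  ... | true  = refl
  ... | false = refl

  -- On the shifted edges of a graph with a new vertex 0, mergeEdges keeps the label of
  -- every old vertex equal to h applied to its label in the run on the original edges,
  -- so both runs meet the same cycles; Inv is what is known about the label of 0.
  module Simulation {m : ℕ} (h : ℕ → ℕ) (h-inj : EqᵇInjective h) (Inv : (Fin (suc m) → ℕ) → Set)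
    (Inv-relabel : ∀ L {L′} a b → LiftsVia h L L′ → Inv L → Inv (relabel L (suc a) (suc b))) where

    Simulates : (Fin (suc m) → ℕ) → (Fin m → ℕ) → Set
    Simulates L L′ = LiftsVia h L L′ × Inv L

    mergeEdges-shift : (es : Edges m) {L : Fin (suc m) → ℕ} {L′ : Fin m → ℕ} → Simulates L L′ →
      Pointwise Simulates (mergeEdges L (map shift es)) (mergeEdges L′ es)
    mergeEdges-shift [] s = just s
    mergeEdges-shift ((a , b) ∷ es) {L} {L′} (lift , inv)
      rewrite trans (cong₂ _≡ᵇ_ (lift a) (lift b)) (h-inj (L′ a) (L′ b)) with L′ a ≡ᵇ L′ b
    ... | true  = nothing
    ... | false = mergeEdges-shift es (relabel-lifts {h = h} h-inj {L} {L′} lift a b , Inv-relabel L a b lift inv)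

  suc-eqᵇInjective : EqᵇInjective suc
  suc-eqᵇInjective _ _ = refl

  IsolatedNew : (Fin (suc m) → ℕ) → Set
  IsolatedNew L = L zero ≡ 0

  relabel-isolatedNew : ∀ (L : Fin (suc m) → ℕ) {L′} a b → LiftsVia suc L L′ →
    IsolatedNew L → IsolatedNew (relabel L (suc a) (suc b))
  relabel-isolatedNew L a b lift L0≡0 rewrite L0≡0 | lift b = refl

  module Isolated {m : ℕ} = Simulation {m} suc suc-eqᵇInjective IsolatedNew relabel-isolatedNew

  components-shift : (F : Edges m) → Pointwise Isolated.Simulates (components (map shift F)) (components F)
  components-shift F = Isolated.mergeEdges-shift F ((λ w → refl) , refl)

  -- Merging the pendant edge (0 , suc j) gives suc j the label 0 of the new vertex.
  sucExcept : ℕ → ℕ → ℕ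
  sucExcept J x = if x ≡ᵇ J then 0 else suc x

  sucExcept-eqᵇInjective : ∀ J → EqᵇInjective (sucExcept J)
  sucExcept-eqᵇInjective J x y with x ≡ᵇ J in x≡J | y ≡ᵇ J in y≡J
  ... | true  | true  = sym (dec-true (x ℕ.≟ y) (trans (≡ᵇ-true⇒≡ x J x≡J) (sym (≡ᵇ-true⇒≡ y J y≡J))))
  ... | true  | false =
    subst (λ z → false ≡ (z ≡ᵇ y)) (sym (≡ᵇ-true⇒≡ x J x≡J)) (sym (trans (≡ᵇ-sym J y) y≡J))
  ... | false | true  = subst (λ z → false ≡ (x ≡ᵇ z)) (sym (≡ᵇ-true⇒≡ y J y≡J)) (sym x≡J)
  ... | false | false = refl

  AnchoredNew : Fin m → (Fin (suc m) → ℕ) → Set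
  AnchoredNew j L = L zero ≡ L (suc j)

  relabel-anchoredNew : (j : Fin m) → ∀ L {L′} a b → LiftsVia (sucExcept (toℕ j)) L L′ →
    AnchoredNew j L → AnchoredNew j (relabel L (suc a) (suc b))
  relabel-anchoredNew j L a b lift anchored rewrite anchored = refl

  module Anchored {m : ℕ} (j : Fin m) =
    Simulation (sucExcept (toℕ j)) (sucExcept-eqᵇInjective (toℕ j)) (AnchoredNew j) (relabel-anchoredNew j)

  components-pendant : (j : Fin m) (F : Edges m) →
    Pointwise (Anchored.Simulates j) (components (pendant j F)) (components F)
  components-pendant j F = Anchored.mergeEdges-shift j F ((λ w → refl) , anchored)
    where
    anchored : AnchoredNew j (relabel toℕ zero (suc j))
    anchored = cong (λ b → if b then 0 else suc (toℕ j)) (sym (≡ᵇ-refl (toℕ j)))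

  all-cong : {A : Set} {p q : A → Bool} → (∀ x → p x ≡ q x) → (xs : List A) → all p xs ≡ all q xs
  all-cong p≗q xs = cong and (map-cong p≗q xs)

  all-allFin-suc : (p : Fin (suc n) → Bool) → all p (allFin (suc n)) ≡ p zero ∧ all (p ∘ suc) (allFin n)
  all-allFin-suc {n} p = trans (cong (all p) (allFin-suc n)) (cong (λ bs → p zero ∧ and bs) (sym (map-∘ (allFin n))))

  all-allFin-false : (p : Fin n → Bool) (i : Fin n) → p i ≡ false → all p (allFin n) ≡ false
  all-allFin-false {suc n} p zero pi≡false = trans (all-allFin-suc p) (cong (_∧ all (p ∘ suc) (allFin n)) pi≡false)
  all-allFin-false {suc n} p (suc i) pi≡false =
    trans (all-allFin-suc p) (trans (cong (p zero ∧_) (all-allFin-false (p ∘ suc) i pi≡false)) (∧-zeroʳ (p zero)))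

  all-allFin-absorb : (p : Fin n → Bool) (i : Fin n) → p i ∧ all p (allFin n) ≡ all p (allFin n)
  all-allFin-absorb p i with p i in pi≡b
  ... | true  = refl
  ... | false = sym (all-allFin-false p i pi≡b)

  meetsQuota-suc : (q : Quota (suc n)) (L : Fin (suc n) → ℕ) (R : List (Fin (suc n))) →
    meetsQuota q L R ≡ meetsQuotaAt q L R zero ∧ all (meetsQuotaAt q L R ∘ suc) (allFin n)
  meetsQuota-suc q L R = all-allFin-suc (meetsQuotaAt q L R)

  meetsQuota-unrooted-root : (L : Fin n → ℕ) (R : List (Fin n)) (r v : Fin n) → L r ≡ L v →
    meetsQuota (unrootedAt v) L (r ∷ R) ≡ false
  meetsQuota-unrooted-root L R r v Lr≡Lv = all-allFin-false (meetsQuotaAt (unrootedAt v) L (r ∷ R)) v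
    (cong₂ _≡ᵇ_ (count-∷-true {p = λ x → L x ≡ᵇ L v} (trans (cong (_≡ᵇ L v) Lr≡Lv) (≡ᵇ-refl (L v))) R)
                 (cong (λ b → if b then 0 else 1) (≡ᵇ-refl (L v))))

  module Lifted {m : ℕ} (h : ℕ → ℕ) (h-inj : EqᵇInjective h) {L : Fin (suc m) → ℕ} {L′ : Fin m → ℕ}
    (lift : LiftsVia h L L′) where

    rootCount-map-suc : ∀ R w → rootCount L (map suc R) (L (suc w)) ≡ rootCount L′ R (L′ w)
    rootCount-map-suc R w = trans (count-map (λ r → L r ≡ᵇ L (suc w)) suc R)
      (count-cong (λ r → trans (cong₂ _≡ᵇ_ (lift r) (lift w)) (h-inj (L′ r) (L′ w))) R)

    required-unrootedAt-suc : ∀ k w → required (unrootedAt (suc k)) L (L (suc w)) ≡ required (unrootedAt k) L′ (L′ w)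
    required-unrootedAt-suc k w rewrite lift w | lift k | h-inj (L′ w) (L′ k) = refl

  restrictQuota : Quota (suc m) → Quota m
  restrictQuota allRooted              = allRooted
  restrictQuota (unrootedAt zero)      = allRooted
  restrictQuota (unrootedAt (suc k))   = unrootedAt k

  newRequired : Quota (suc m) → ℕ
  newRequired allRooted            = 1
  newRequired (unrootedAt zero)    = 0
  newRequired (unrootedAt (suc k)) = 1

  module QuotaIsolated {m : ℕ} {L : Fin (suc m) → ℕ} {L′ : Fin m → ℕ}
    (lift : LiftsVia suc L L′) (isolated : IsolatedNew L) where

    open Lifted suc suc-eqᵇInjective {L} {L′} lift

    required-new : ∀ q → required q L (L zero) ≡ newRequired q
    required-new allRooted            = refl
    required-new (unrootedAt zero)    = cong (λ b → if b then 0 else 1) (≡ᵇ-refl (L zero))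
    required-new (unrootedAt (suc k)) = cong (λ b → if b then 0 else 1) (cong₂ _≡ᵇ_ isolated (lift k))

    required-old : ∀ q w → required q L (L (suc w)) ≡ required (restrictQuota q) L′ (L′ w)
    required-old allRooted            w = refl
    required-old (unrootedAt zero)    w = cong (λ b → if b then 0 else 1) (cong₂ _≡ᵇ_ (lift w) isolated)
    required-old (unrootedAt (suc k)) w = required-unrootedAt-suc k w

    meetsQuota-isolated : ∀ q (R₀ : List (Fin (suc m))) (R : List (Fin m)) →
      (∀ w → rootCount L R₀ (L (suc w)) ≡ rootCount L′ R (L′ w)) →
      meetsQuota q L R₀ ≡ (rootCount L R₀ (L zero) ≡ᵇ newRequired q) ∧ meetsQuota (restrictQuota q) L′ R
    meetsQuota-isolated q R₀ R counts = trans (meetsQuota-suc q L R₀)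
      (cong₂ _∧_ (cong (rootCount L R₀ (L zero) ≡ᵇ_) (required-new q))
                 (all-cong (λ w → cong₂ _≡ᵇ_ (counts w) (required-old q w)) (allFin m)))

    new-apart : ∀ w → (L zero ≡ᵇ L (suc w)) ≡ false
    new-apart w = cong₂ _≡ᵇ_ isolated (lift w)

    rootCount-new-nonroot : ∀ R → rootCount L (map suc R) (L zero) ≡ 0
    rootCount-new-nonroot R = trans (count-map (λ r → L r ≡ᵇ L zero) suc R)
      (trans (count-cong (λ r → cong₂ _≡ᵇ_ (lift r) isolated) R) (count-false R))

    meetsQuota-isolated-nonroot : ∀ q R →
      meetsQuota q L (map suc R) ≡ (0 ≡ᵇ newRequired q) ∧ meetsQuota (restrictQuota q) L′ R
    meetsQuota-isolated-nonroot q R = trans (meetsQuota-isolated q (map suc R) R (rootCount-map-suc R))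
      (cong (λ c → (c ≡ᵇ newRequired q) ∧ _) (rootCount-new-nonroot R))

    meetsQuota-isolated-root : ∀ q R →
      meetsQuota q L (zero ∷ map suc R) ≡ (1 ≡ᵇ newRequired q) ∧ meetsQuota (restrictQuota q) L′ R
    meetsQuota-isolated-root q R = trans
      (meetsQuota-isolated q (zero ∷ map suc R) R
         (λ w → trans (count-∷-false {p = λ r → L r ≡ᵇ L (suc w)} (new-apart w) (map suc R)) (rootCount-map-suc R w)))
      (cong (λ c → (c ≡ᵇ newRequired q) ∧ _)
         (trans (count-∷-true {p = λ r → L r ≡ᵇ L zero} (≡ᵇ-refl (L zero)) (map suc R))
                (cong suc (rootCount-new-nonroot R))))

  contractQuota : Fin m → Quota (suc m) → Quota m
  contractQuota j allRooted            = allRooted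
  contractQuota j (unrootedAt zero)    = unrootedAt j
  contractQuota j (unrootedAt (suc k)) = unrootedAt k

  module QuotaAnchored {m : ℕ} (j : Fin m) {L : Fin (suc m) → ℕ} {L′ : Fin m → ℕ}
    (lift : LiftsVia (sucExcept (toℕ j)) L L′) (anchored : AnchoredNew j L) where

    open Lifted (sucExcept (toℕ j)) (sucExcept-eqᵇInjective (toℕ j)) {L} {L′} lift

    meetsQuota-anchored : ∀ q R₀ → meetsQuota q L R₀ ≡ all (meetsQuotaAt q L R₀ ∘ suc) (allFin m)
    meetsQuota-anchored q R₀ = trans (meetsQuota-suc q L R₀)
      (trans (cong (_∧ all (meetsQuotaAt q L R₀ ∘ suc) (allFin m))
                   (cong (λ x → rootCount L R₀ x ≡ᵇ required q L x) anchored))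
             (all-allFin-absorb (meetsQuotaAt q L R₀ ∘ suc) j))

    required-old : ∀ q w → required q L (L (suc w)) ≡ required (contractQuota j q) L′ (L′ w)
    required-old allRooted            w = refl
    required-old (unrootedAt zero)    w = trans (cong (λ x → if L (suc w) ≡ᵇ x then 0 else 1) anchored)
                                                (required-unrootedAt-suc j w)
    required-old (unrootedAt (suc k)) w = required-unrootedAt-suc k w

    meetsQuota-pendant-nonroot : ∀ q R → meetsQuota q L (map suc R) ≡ meetsQuota (contractQuota j q) L′ R
    meetsQuota-pendant-nonroot q R = trans (meetsQuota-anchored q (map suc R))
      (all-cong (λ w → cong₂ _≡ᵇ_ (rootCount-map-suc R w) (required-old q w)) (allFin m))

    meetsQuota-pendant-root : ∀ R → meetsQuota allRooted L (zero ∷ map suc R) ≡ meetsQuota (unrootedAt j) L′ R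
    meetsQuota-pendant-root R = trans (meetsQuota-anchored allRooted (zero ∷ map suc R))
      (all-cong at-old (allFin m))
      where
      same-tree : ∀ w → (L zero ≡ᵇ L (suc w)) ≡ (L′ w ≡ᵇ L′ j)
      same-tree w = trans (cong₂ _≡ᵇ_ (trans anchored (lift j)) (lift w))
                          (trans (sucExcept-eqᵇInjective (toℕ j) (L′ j) (L′ w)) (≡ᵇ-sym (L′ j) (L′ w)))
      at-old : ∀ w → meetsQuotaAt allRooted L (zero ∷ map suc R) (suc w) ≡ meetsQuotaAt (unrootedAt j) L′ R w
      at-old w with L′ w ≡ᵇ L′ j in e
      ... | true  = cong (_≡ᵇ 1)
        (trans (count-∷-true {p = λ r → L r ≡ᵇ L (suc w)} (trans (same-tree w) e) (map suc R))
               (cong suc (rootCount-map-suc R w)))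
      ... | false = cong (_≡ᵇ 1)
        (trans (count-∷-false {p = λ r → L r ≡ᵇ L (suc w)} (trans (same-tree w) e) (map suc R))
               (rootCount-map-suc R w))

  maybe′-pointwise : {A B : Set} {R : A → B → Set} {f : A → Bool} {g : B → Bool}
    (k : Bool → Bool) → k false ≡ false → (∀ {x y} → R x y → f x ≡ k (g y)) →
    ∀ {mx my} → Pointwise R mx my → maybe′ f false mx ≡ k (maybe′ g false my)
  maybe′-pointwise k k-false f≡kg (just Rxy) = f≡kg Rxy
  maybe′-pointwise k k-false f≡kg nothing    = sym k-false

  maybe′-pointwise-false : {A B : Set} {R : A → B → Set} {f : A → Bool} →
    (∀ {x y} → R x y → f x ≡ false) → ∀ {mx my} → Pointwise R mx my → maybe′ f false mx ≡ false
  maybe′-pointwise-false f≡false (just Rxy) = f≡false Rxy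
  maybe′-pointwise-false f≡false nothing    = refl

  module _ {m : ℕ} (q : Quota (suc m)) (F : Edges m) (R : List (Fin m)) where

    isForestWith-isolated-nonroot : isForestWith q (map shift F) (map suc R)
                                  ≡ (0 ≡ᵇ newRequired q) ∧ isForestWith (restrictQuota q) F R
    isForestWith-isolated-nonroot = maybe′-pointwise (_ ∧_) (∧-zeroʳ _)
      (λ {L} {L′} (lift , isolated) → QuotaIsolated.meetsQuota-isolated-nonroot {L = L} {L′} lift isolated q R)
      (components-shift F)

    isForestWith-isolated-root : isForestWith q (map shift F) (zero ∷ map suc R)
                               ≡ (1 ≡ᵇ newRequired q) ∧ isForestWith (restrictQuota q) F R
    isForestWith-isolated-root = maybe′-pointwise (_ ∧_) (∧-zeroʳ _)
      (λ {L} {L′} (lift , isolated) → QuotaIsolated.meetsQuota-isolated-root {L = L} {L′} lift isolated q R)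
      (components-shift F)

  module _ {m : ℕ} (j : Fin m) (F : Edges m) (R : List (Fin m)) where

    isForestWith-pendant-nonroot : ∀ q → isForestWith q (pendant j F) (map suc R) ≡ isForestWith (contractQuota j q) F R
    isForestWith-pendant-nonroot q = maybe′-pointwise id refl
      (λ {L} {L′} (lift , anchored) → QuotaAnchored.meetsQuota-pendant-nonroot j {L} {L′} lift anchored q R)
      (components-pendant j F)

    isForestWith-pendant-root : isForestWith allRooted (pendant j F) (zero ∷ map suc R) ≡ isForestWith (unrootedAt j) F R
    isForestWith-pendant-root = maybe′-pointwise id refl
      (λ {L} {L′} (lift , anchored) → QuotaAnchored.meetsQuota-pendant-root j {L} {L′} lift anchored R)
      (components-pendant j F)

    isForestWith-pendant-root-unrootedNew : isForestWith (unrootedAt zero) (pendant j F) (zero ∷ map suc R) ≡ false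
    isForestWith-pendant-root-unrootedNew = maybe′-pointwise-false
      (λ {L} _ → meetsQuota-unrooted-root L (map suc R) zero zero refl) (components-pendant j F)

    isForestWith-pendant-root-unrootedAnchor : isForestWith (unrootedAt (suc j)) (pendant j F) (zero ∷ map suc R) ≡ false
    isForestWith-pendant-root-unrootedAnchor = maybe′-pointwise-false
      (λ {L} (_ , anchored) → meetsQuota-unrooted-root L (map suc R) zero (suc j) anchored) (components-pendant j F)

  hasRoot-map-suc : (i : Maybe (Fin m)) (R : List (Fin m)) → hasRoot (Maybe.map suc i) (map suc R) ≡ hasRoot i R
  hasRoot-map-suc nothing  R       = refl
  hasRoot-map-suc (just i) []      = refl
  hasRoot-map-suc (just i) (r ∷ R) =
    cong₂ _∨_ (⌊⌋-map′ (cong suc) suc-injective (r ≟ i)) (hasRoot-map-suc (just i) R)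

  hasRoot-zero∷map-suc : (i : Maybe (Fin m)) (R : List (Fin m)) →
    hasRoot (Maybe.map suc i) (zero ∷ map suc R) ≡ hasRoot i R
  hasRoot-zero∷map-suc nothing  R = refl
  hasRoot-zero∷map-suc (just i) R = hasRoot-map-suc (just i) R

  hasRoot-zero-map-suc : (R : List (Fin m)) → hasRoot (just zero) (map suc R) ≡ false
  hasRoot-zero-map-suc []      = refl
  hasRoot-zero-map-suc (r ∷ R) = hasRoot-zero-map-suc R

  countCandidates-cong : (E : Edges n) {P Q : Edges n → List (Fin n) → Bool} →
    (∀ F R → P F R ≡ Q F R) → countCandidates E P ≡ countCandidates E Q
  countCandidates-cong E P≗Q = count-cong (λ (F , R) → P≗Q F R) (candidates E)

  countCandidates-false : (E : Edges n) {P : Edges n → List (Fin n) → Bool} →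
    (∀ F R → P F R ≡ false) → countCandidates E P ≡ 0
  countCandidates-false E P≗false = trans (countCandidates-cong E P≗false) (count-false (candidates E))

  module Pendant {m : ℕ} (j : Fin m) (E : Edges m) where

    blockCount : Quota (suc m) → Maybe (Fin (suc m)) →
      (Edges m → Edges (suc m)) → (List (Fin m) → List (Fin (suc m))) → ℕ
    blockCount q i g h = countCandidates E (λ F R → isForestWith q (g F) (h R) ∧ hasRoot i (h R))

    forestCount-blocks : ∀ q i → forestCount (pendant j E) q i
      ≡ (blockCount q i (map shift) (map suc) + blockCount q i (map shift) ((zero ∷_) ∘ map suc))
        + (blockCount q i (pendant j) (map suc) + blockCount q i (pendant j) ((zero ∷_) ∘ map suc))
    forestCount-blocks q i = countCandidates-pendant j E _

    rootedAnchorCount : Quota (suc m) → Maybe (Fin m) → ℕ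
    rootedAnchorCount q i = countCandidates E (λ F R → isForestWith q (pendant j F) (zero ∷ map suc R) ∧ hasRoot i R)

    blockCount-isolated : ∀ q i →
        blockCount q (Maybe.map suc i) (map shift) (map suc)
      + blockCount q (Maybe.map suc i) (map shift) ((zero ∷_) ∘ map suc)
      ≡ forestCount E (restrictQuota q) i
    blockCount-isolated q i = trans
      (cong₂ _+_ (countCandidates-cong E λ F R → cong₂ _∧_ (isForestWith-isolated-nonroot q F R) (hasRoot-map-suc i R))
                 (countCandidates-cong E λ F R → cong₂ _∧_ (isForestWith-isolated-root q F R) (hasRoot-zero∷map-suc i R)))
      (by-cases q)
      where
      by-cases : ∀ q →
          countCandidates E (λ F R → ((0 ≡ᵇ newRequired q) ∧ isForestWith (restrictQuota q) F R) ∧ hasRoot i R)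
        + countCandidates E (λ F R → ((1 ≡ᵇ newRequired q) ∧ isForestWith (restrictQuota q) F R) ∧ hasRoot i R)
        ≡ forestCount E (restrictQuota q) i
      by-cases allRooted            = cong (_+ forestCount E allRooted i) (count-false (candidates E))
      by-cases (unrootedAt zero)    = trans (cong (forestCount E allRooted i +_) (count-false (candidates E)))
                                            (+-identityʳ (forestCount E allRooted i))
      by-cases (unrootedAt (suc k)) = cong (_+ forestCount E (unrootedAt k) i) (count-false (candidates E))

    blockCount-pendant-nonroot : ∀ q i → blockCount q (Maybe.map suc i) (pendant j) (map suc) ≡ forestCount E (contractQuota j q) i
    blockCount-pendant-nonroot q i =
      countCandidates-cong E λ F R → cong₂ _∧_ (isForestWith-pendant-nonroot j F R q) (hasRoot-map-suc i R)

    blockCount-pendant-root : ∀ q i → blockCount q (Maybe.map suc i) (pendant j) ((zero ∷_) ∘ map suc) ≡ rootedAnchorCount q i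
    blockCount-pendant-root q i = countCandidates-cong E λ F R → cong (_ ∧_) (hasRoot-zero∷map-suc i R)

    blockCount-newNonroot : ∀ q g → blockCount q (just zero) g (map suc) ≡ 0
    blockCount-newNonroot q g = countCandidates-false E λ F R →
      trans (cong (isForestWith q (g F) (map suc R) ∧_) (hasRoot-zero-map-suc R)) (∧-zeroʳ _)

    -- The new vertex is isolated (and a root exactly when the quota demands it), or a
    -- non-root of the tree of j, or the root of that tree.
    forestCount-pendant : ∀ q i → forestCount (pendant j E) q (Maybe.map suc i)
      ≡ forestCount E (restrictQuota q) i + forestCount E (contractQuota j q) i + rootedAnchorCount q i
    forestCount-pendant q i = begin
      forestCount (pendant j E) q (Maybe.map suc i)
        ≡⟨ forestCount-blocks q (Maybe.map suc i) ⟩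
      (isolatedNonroot + isolatedRoot) + (pendantNonroot + pendantRoot)
        ≡⟨ sym (+-assoc (isolatedNonroot + isolatedRoot) pendantNonroot pendantRoot) ⟩
      isolatedNonroot + isolatedRoot + pendantNonroot + pendantRoot
        ≡⟨ cong₂ _+_ (cong₂ _+_ (blockCount-isolated q i) (blockCount-pendant-nonroot q i)) (blockCount-pendant-root q i) ⟩
      forestCount E (restrictQuota q) i + forestCount E (contractQuota j q) i + rootedAnchorCount q i ∎
      where
      open ≡-Reasoning
      isolatedNonroot = blockCount q (Maybe.map suc i) (map shift) (map suc)
      isolatedRoot    = blockCount q (Maybe.map suc i) (map shift) ((zero ∷_) ∘ map suc)
      pendantNonroot  = blockCount q (Maybe.map suc i) (pendant j) (map suc)
      pendantRoot     = blockCount q (Maybe.map suc i) (pendant j) ((zero ∷_) ∘ map suc)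

    rootedAnchorCount-allRooted : ∀ i → rootedAnchorCount allRooted i ≡ forestCount E (unrootedAt j) i
    rootedAnchorCount-allRooted i = countCandidates-cong E λ F R → cong (_∧ hasRoot i R) (isForestWith-pendant-root j F R)

    rootedAnchorCount-unrootedNew : ∀ i → rootedAnchorCount (unrootedAt zero) i ≡ 0
    rootedAnchorCount-unrootedNew i = countCandidates-false E λ F R →
      cong (_∧ hasRoot i R) (isForestWith-pendant-root-unrootedNew j F R)

    rootedAnchorCount-unrootedAnchor : ∀ i → rootedAnchorCount (unrootedAt (suc j)) i ≡ 0
    rootedAnchorCount-unrootedAnchor i = countCandidates-false E λ F R →
      cong (_∧ hasRoot i R) (isForestWith-pendant-root-unrootedAnchor j F R)

    forestCount-pendant-allRooted : ∀ i → forestCount (pendant j E) allRooted (Maybe.map suc i)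
      ≡ forestCount E allRooted i + forestCount E allRooted i + forestCount E (unrootedAt j) i
    forestCount-pendant-allRooted i = trans (forestCount-pendant allRooted i)
      (cong (forestCount E allRooted i + forestCount E allRooted i +_) (rootedAnchorCount-allRooted i))

    forestCount-pendant-unrootedNew : ∀ i → forestCount (pendant j E) (unrootedAt zero) (Maybe.map suc i)
      ≡ forestCount E allRooted i + forestCount E (unrootedAt j) i
    forestCount-pendant-unrootedNew i = trans (forestCount-pendant (unrootedAt zero) i)
      (trans (cong (forestCount E allRooted i + forestCount E (unrootedAt j) i +_) (rootedAnchorCount-unrootedNew i))
             (+-identityʳ _))

    forestCount-pendant-unrootedAnchor : ∀ i → forestCount (pendant j E) (unrootedAt (suc j)) (Maybe.map suc i)
      ≡ forestCount E (unrootedAt j) i + forestCount E (unrootedAt j) i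
    forestCount-pendant-unrootedAnchor i = trans (forestCount-pendant (unrootedAt (suc j)) i)
      (trans (cong (forestCount E (unrootedAt j) i + forestCount E (unrootedAt j) i +_) (rootedAnchorCount-unrootedAnchor i))
             (+-identityʳ _))

    forestCount-pendant-rootedNew : forestCount (pendant j E) allRooted (just zero)
      ≡ forestCount E allRooted nothing + forestCount E (unrootedAt j) nothing
    forestCount-pendant-rootedNew = trans (forestCount-blocks allRooted (just zero))
      (cong₂ _+_ (cong₂ _+_ (blockCount-newNonroot allRooted (map shift))
                            (countCandidates-cong E λ F R → cong (_∧ true) (isForestWith-isolated-root allRooted F R)))
                 (cong₂ _+_ (blockCount-newNonroot allRooted (pendant j))
                            (rootedAnchorCount-allRooted nothing)))

    forestCount-pendant-unrootedNew-rootedNew : forestCount (pendant j E) (unrootedAt zero) (just zero) ≡ 0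
    forestCount-pendant-unrootedNew-rootedNew = trans (forestCount-blocks (unrootedAt zero) (just zero))
      (cong₂ _+_ (cong₂ _+_ (blockCount-newNonroot (unrootedAt zero) (map shift))
                            (countCandidates-false E λ F R →
                               cong (_∧ true) (isForestWith-isolated-root (unrootedAt zero) F R)))
                 (cong₂ _+_ (blockCount-newNonroot (unrootedAt zero) (pendant j))
                            (rootedAnchorCount-unrootedNew nothing)))

  path : (n : ℕ) → Edges (suc n)
  path n = pathEdges (suc n)

  T-pendant : ∀ k → TEdges k ≡ pendant (suc zero) (path (suc k))
  T-pendant k = cong (λ es → (zero , suc (suc zero)) ∷ (suc zero , suc (suc zero)) ∷ es) (map-∘ (pathEdges (suc k)))

  -- f and f₁₁ of the path on n + 1 vertices: the Fibonacci numbers F₂ₙ₊₂ and F₂ₙ₊₁.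
  pathForests pathRooted : ℕ → ℕ
  pathForests zero    = 1
  pathForests (suc n) = pathForests n + pathForests n + pathRooted n
  pathRooted zero    = 1
  pathRooted (suc n) = pathForests n + pathRooted n

  cassini-step : ∀ F G → ((F + G) * (F + G) + (F + G) * (F + F + G)) + (F * F + 1)
                       ≡ ((F + F + G) * (F + F + G) + 1) + (G * G + G * F)
  cassini-step = solve-∀

  path-cassini : ∀ n → pathRooted n * pathRooted n + pathRooted n * pathForests n ≡ pathForests n * pathForests n + 1
  path-cassini zero    = refl
  path-cassini (suc n) = +-cancelʳ-≡ (F * F + 1) _ _
    (trans (cassini-step F G) (cong (pathForests (suc n) * pathForests (suc n) + 1 +_) (path-cassini n)))
    where
    F = pathForests n
    G = pathRooted n

  open Pendant using (forestCount-pendant-allRooted; forestCount-pendant-unrootedNew; forestCount-pendant-unrootedAnchor;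
                      forestCount-pendant-rootedNew; forestCount-pendant-unrootedNew-rootedNew)

  path-forests : ∀ n → forestCount (path n) allRooted nothing ≡ pathForests n
  path-unrootedFirst : ∀ n → forestCount (path n) (unrootedAt zero) nothing ≡ pathRooted n

  path-forests zero    = refl
  path-forests (suc n) = trans (forestCount-pendant-allRooted zero (path n) nothing)
    (cong₂ (λ F G → F + F + G) (path-forests n) (path-unrootedFirst n))

  path-unrootedFirst zero    = refl
  path-unrootedFirst (suc n) = trans (forestCount-pendant-unrootedNew zero (path n) nothing)
    (cong₂ _+_ (path-forests n) (path-unrootedFirst n))

  path-rootedFirst : ∀ n → forestCount (path n) allRooted (just zero) ≡ pathRooted n
  path-rootedFirst zero    = refl
  path-rootedFirst (suc n) = trans (forestCount-pendant-rootedNew zero (path n))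
    (cong₂ _+_ (path-forests n) (path-unrootedFirst n))

  path-unrootedFirst-rootedFirst : ∀ n → forestCount (path n) (unrootedAt zero) (just zero) ≡ 0
  path-unrootedFirst-rootedFirst zero    = refl
  path-unrootedFirst-rootedFirst (suc n) = forestCount-pendant-unrootedNew-rootedNew zero (path n)

  path-rootedLast : ∀ n → forestCount (path n) allRooted (just (fromℕ n)) ≡ pathRooted n
  path-unrootedFirst-rootedLast : ∀ n →
    forestCount (path n) (unrootedAt zero) (just (fromℕ n)) + pathRooted n ≡ pathForests n

  path-rootedLast zero    = refl
  path-rootedLast (suc n) = begin
    forestCount (path (suc n)) allRooted (just (fromℕ (suc n)))
      ≡⟨ forestCount-pendant-allRooted zero (path n) (just (fromℕ n)) ⟩
    RL + RL + Z
      ≡⟨ cong (λ x → x + x + Z) (path-rootedLast n) ⟩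
    G + G + Z
      ≡⟨ rearrange G Z ⟩
    Z + G + G
      ≡⟨ cong (_+ G) (path-unrootedFirst-rootedLast n) ⟩
    pathForests n + G ∎
    where
    open ≡-Reasoning
    G = pathRooted n
    RL = forestCount (path n) allRooted (just (fromℕ n))
    Z = forestCount (path n) (unrootedAt zero) (just (fromℕ n))
    rearrange : ∀ G Z → G + G + Z ≡ Z + G + G
    rearrange = solve-∀

  path-unrootedFirst-rootedLast zero    = refl
  path-unrootedFirst-rootedLast (suc n) = begin
    forestCount (path (suc n)) (unrootedAt zero) (just (fromℕ (suc n))) + pathRooted (suc n)
      ≡⟨ cong (_+ pathRooted (suc n)) (forestCount-pendant-unrootedNew zero (path n) (just (fromℕ n))) ⟩
    RL + Z + (F + G)
      ≡⟨ cong (λ x → x + Z + (F + G)) (path-rootedLast n) ⟩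
    G + Z + (F + G)
      ≡⟨ rearrange F G Z ⟩
    F + (Z + G) + G
      ≡⟨ cong (λ x → F + x + G) (path-unrootedFirst-rootedLast n) ⟩
    F + F + G ∎
    where
    open ≡-Reasoning
    F = pathForests n
    G = pathRooted n
    RL = forestCount (path n) allRooted (just (fromℕ n))
    Z = forestCount (path n) (unrootedAt zero) (just (fromℕ n))
    rearrange : ∀ F G Z → G + Z + (F + G) ≡ F + (Z + G) + G
    rearrange = solve-∀

  T-forests : ∀ k → f (TEdges k) ≡ 4 * pathForests k + 4 * pathRooted k
  T-forests k = begin
    f (TEdges k)
      ≡⟨ trans (f≡forestCount (TEdges k)) (cong (λ E → forestCount E allRooted nothing) (T-pendant k)) ⟩
    forestCount (pendant (suc zero) (path (suc k))) allRooted nothing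
      ≡⟨ forestCount-pendant-allRooted (suc zero) (path (suc k)) nothing ⟩
    F₁ + F₁ + forestCount (path (suc k)) (unrootedAt (suc zero)) nothing
      ≡⟨ cong₂ (λ x y → x + x + y) (path-forests (suc k)) (forestCount-pendant-unrootedAnchor zero (path k) nothing) ⟩
    pathForests (suc k) + pathForests (suc k) + (U + U)
      ≡⟨ cong (λ x → pathForests (suc k) + pathForests (suc k) + (x + x)) (path-unrootedFirst k) ⟩
    (F + F + G) + (F + F + G) + (G + G)
      ≡⟨ collect F G ⟩
    4 * F + 4 * G ∎
    where
    open ≡-Reasoning
    F = pathForests k
    G = pathRooted k
    F₁ = forestCount (path (suc k)) allRooted nothing
    U = forestCount (path k) (unrootedAt zero) nothing
    collect : ∀ F G → (F + F + G) + (F + F + G) + (G + G) ≡ 4 * F + 4 * G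
    collect = solve-∀

  T-rootedEnd : ∀ k → fii (TEdges k) (fromℕ (suc (suc k))) ≡ 4 * pathForests k
  T-rootedEnd k = begin
    fii (TEdges k) (fromℕ (suc (suc k)))
      ≡⟨ trans (fii≡forestCount (TEdges k) _)
               (cong (λ E → forestCount E allRooted (just (fromℕ (suc (suc k))))) (T-pendant k)) ⟩
    forestCount (pendant (suc zero) (path (suc k))) allRooted (just (fromℕ (suc (suc k))))
      ≡⟨ forestCount-pendant-allRooted (suc zero) (path (suc k)) (just (fromℕ (suc k))) ⟩
    RL₁ + RL₁ + forestCount (path (suc k)) (unrootedAt (suc zero)) (just (fromℕ (suc k)))
      ≡⟨ cong₂ (λ x y → x + x + y) (path-rootedLast (suc k))
               (forestCount-pendant-unrootedAnchor zero (path k) (just (fromℕ k))) ⟩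
    (F + G) + (F + G) + (Z + Z)
      ≡⟨ rearrange F G Z ⟩
    F + F + (Z + G) + (Z + G)
      ≡⟨ cong (λ x → F + F + x + x) (path-unrootedFirst-rootedLast k) ⟩
    F + F + F + F
      ≡⟨ collect F ⟩
    4 * F ∎
    where
    open ≡-Reasoning
    F = pathForests k
    G = pathRooted k
    RL₁ = forestCount (path (suc k)) allRooted (just (fromℕ (suc k)))
    Z = forestCount (path k) (unrootedAt zero) (just (fromℕ k))
    rearrange : ∀ F G Z → (F + G) + (F + G) + (Z + Z) ≡ F + F + (Z + G) + (Z + G)
    rearrange = solve-∀
    collect : ∀ F → F + F + F + F ≡ 4 * F
    collect = solve-∀

  T-rootedCentre : ∀ k → fii (TEdges k) (suc (suc zero)) ≡ 4 * pathRooted k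
  T-rootedCentre k = begin
    fii (TEdges k) (suc (suc zero))
      ≡⟨ trans (fii≡forestCount (TEdges k) _)
               (cong (λ E → forestCount E allRooted (just (suc (suc zero)))) (T-pendant k)) ⟩
    forestCount (pendant (suc zero) (path (suc k))) allRooted (just (suc (suc zero)))
      ≡⟨ forestCount-pendant-allRooted (suc zero) (path (suc k)) (just (suc zero)) ⟩
    R₁ + R₁ + forestCount (path (suc k)) (unrootedAt (suc zero)) (just (suc zero))
      ≡⟨ cong₂ (λ x y → x + x + y) (forestCount-pendant-allRooted zero (path k) (just zero))
               (forestCount-pendant-unrootedAnchor zero (path k) (just zero)) ⟩
    (R₀ + R₀ + U₀) + (R₀ + R₀ + U₀) + (U₀ + U₀)
      ≡⟨ cong₂ (λ x y → (x + x + y) + (x + x + y) + (y + y)) (path-rootedFirst k) (path-unrootedFirst-rootedFirst k) ⟩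
    (G + G + 0) + (G + G + 0) + 0
      ≡⟨ collect G ⟩
    4 * G ∎
    where
    open ≡-Reasoning
    G = pathRooted k
    R₁ = forestCount (path (suc k)) allRooted (just (suc zero))
    R₀ = forestCount (path k) allRooted (just zero)
    U₀ = forestCount (path k) (unrootedAt zero) (just zero)
    collect : ∀ G → (G + G + 0) + (G + G + 0) + 0 ≡ 4 * G
    collect = solve-∀

  pathRooted-positive : ∀ n → 1 ≤ pathRooted n
  pathRooted-positive zero    = s≤s z≤n
  pathRooted-positive (suc n) = ≤-trans (pathRooted-positive n) (m≤n+m (pathRooted n) (pathForests n))

  pathForests-growth : ∀ n → n < pathForests n
  pathForests-growth zero    = s≤s z≤n
  pathForests-growth (suc n) = ≤-trans (s≤s (pathForests-growth n))
    (≤-trans (s≤s (m≤m+n F F)) (m<m+n (F + F) (pathRooted-positive n)))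
    where F = pathForests n

  path-f : ∀ n → f (path n) ≡ pathForests n
  path-f n = trans (f≡forestCount (path n)) (path-forests n)

  path-fii : ∀ n → fii (path n) zero ≡ pathRooted n
  path-fii n = trans (fii≡forestCount (path n) zero) (path-rootedFirst n)

  path-identity : ∀ n → let a = fii (path n) zero; b = f (path n) in a * a + a * b + 0 ≡ b * b + 1
  path-identity n rewrite path-fii n | path-f n = trans (+-identityʳ _) (path-cassini n)

  path-growth : ∀ n → n < f (path n)
  path-growth n = subst (n <_) (sym (path-f n)) (pathForests-growth n)

  T-identity : ∀ k → let a = fii (TEdges k) (fromℕ (suc (suc k))); b = f (TEdges k) in a * a + a * b + 16 ≡ b * b + 0
  T-identity k rewrite T-rootedEnd k | T-forests k = begin
    4 * F * (4 * F) + 4 * F * (4 * F + 4 * G) + 16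
      ≡⟨ expand F G ⟩
    16 * (F * F + 1) + 16 * (F * F) + 16 * (F * G)
      ≡⟨ cong (λ x → 16 * x + 16 * (F * F) + 16 * (F * G)) (path-cassini k) ⟨
    16 * (G * G + G * F) + 16 * (F * F) + 16 * (F * G)
      ≡⟨ collect F G ⟩
    (4 * F + 4 * G) * (4 * F + 4 * G) + 0 ∎
    where
    open ≡-Reasoning
    F = pathForests k
    G = pathRooted k
    expand : ∀ F G → 4 * F * (4 * F) + 4 * F * (4 * F + 4 * G) + 16 ≡ 16 * (F * F + 1) + 16 * (F * F) + 16 * (F * G)
    expand = solve-∀
    collect : ∀ F G → 16 * (G * G + G * F) + 16 * (F * F) + 16 * (F * G) ≡ (4 * F + 4 * G) * (4 * F + 4 * G) + 0
    collect = solve-∀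

  T-growth : ∀ k → k < f (TEdges k)
  T-growth k = subst (k <_) (sym (T-forests k))
    (≤-trans (pathForests-growth k) (≤-trans (m≤n*m (pathForests k) 4) (m≤m+n _ _)))

  T-positive : ∀ k → 0 < f (TEdges k)
  T-positive k = ≤-trans (s≤s z≤n) (T-growth k)

  T-centre+end : ∀ k → fii (TEdges k) (suc (suc zero)) + fii (TEdges k) (fromℕ (suc (suc k))) ≡ f (TEdges k)
  T-centre+end k rewrite T-rootedCentre k | T-rootedEnd k | T-forests k = +-comm (4 * pathRooted k) (4 * pathForests k)

module GoldenRatio where

  open import Data.Integer as ℤ using (+_; +[1+_]; -[1+_])
  import Data.Integer.Properties as ℤ
  open import Data.Integer.Tactic.RingSolver using () renaming (solve-∀ to ℤ-solve-∀)
  import Data.Nat as ℕ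
  open import Data.Nat.Coprimality using (Coprime)
  import Data.Nat.Properties as ℕ
  open import Data.Product using (_,_)
  open import Data.Rational using (ℚ; mkℚ; 0ℚ; 1ℚ; _+_; _-_; _*_; _<_; _≤_; -_; toℚᵘ; nonNegative)
  import Data.Rational as ℚ
  open import Data.Rational.Properties
  open import Data.Rational.Solver using (module +-*-Solver)
  open import Data.Rational.Unnormalised as ℚᵘ using (ℚᵘ; mkℚᵘ; _≃_; *≡*; *<*)
  import Data.Rational.Unnormalised.Properties as ℚᵘ
  open import Data.Sum using (inj₁; inj₂)
  open import Relation.Binary.Definitions using (tri<; tri≈; tri>)
  open import Relation.Binary.PropositionalEquality

  NearGolden : ℚ → ℚ → Set
  NearGolden ε x = (x * x + x < 1ℚ + ε) × (1ℚ < x * x + x + ε)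

  private
    0≤*  : ∀ {p q} → 0ℚ ≤ p → 0ℚ ≤ q → 0ℚ ≤ p * q
    0≤* {p} {q} 0≤p 0≤q =
      nonNegative⁻¹ (p * q) {{nonNeg*nonNeg⇒nonNeg p {{nonNegative 0≤p}} q {{nonNegative 0≤q}}}}

    0≤+ : ∀ {p q} → 0ℚ ≤ p → 0ℚ ≤ q → 0ℚ ≤ p + q
    0≤+ {p} {q} 0≤p 0≤q =
      nonNegative⁻¹ (p + q) {{nonNeg+nonNeg⇒nonNeg p {{nonNegative 0≤p}} q {{nonNegative 0≤q}}}}

    p≤p+q : ∀ p {q} → 0ℚ ≤ q → p ≤ p + q
    p≤p+q p {q} 0≤q = subst (_≤ p + q) (+-identityʳ p) (+-monoʳ-≤ p 0≤q)

  nearGolden-bracket : ∀ {ε x} → 0ℚ < ε → 0ℚ ≤ x → NearGolden ε x → ((x - ε) <φ⁻¹) × (φ⁻¹< (x + ε))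
  nearGolden-bracket {ε} {x} 0<ε 0≤x (upper , lower) = below , (0<x+ε , above)
    where
    open ≤-Reasoning
    open +-*-Solver
    0≤ε = <⇒≤ 0<ε
    y = x - ε

    y²+y<1 : 0ℚ ≤ y → y * y + y < 1ℚ
    y²+y<1 0≤y = begin-strict
      y * y + y                    ≤⟨ p≤p+q (y * y + y) (0≤* 0≤ε (0≤+ 0≤x 0≤y)) ⟩
      y * y + y + ε * (x + y)      ≡⟨ solve 2 (λ x ε → ((x :- ε) :* (x :- ε) :+ (x :- ε)) :+ ε :* (x :+ (x :- ε))
                                                := (x :* x :+ x) :- ε) refl x ε ⟩
      (x * x + x) - ε              <⟨ +-monoˡ-< (- ε) upper ⟩
      (1ℚ + ε) - ε                 ≡⟨ solve 1 (λ ε → (con 1ℚ :+ ε) :- ε := con 1ℚ) refl ε ⟩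
      1ℚ ∎

    below : (x - ε) <φ⁻¹
    below with <-cmp y 0ℚ
    ... | tri< y<0 _ _ = inj₁ y<0
    ... | tri≈ _ y≡0 _ = inj₂ (y²+y<1 (≤-reflexive (sym y≡0)))
    ... | tri> _ _ y>0 = inj₂ (y²+y<1 (<⇒≤ y>0))

    0<x+ε : 0ℚ < x + ε
    0<x+ε = subst (_< x + ε) (+-identityʳ 0ℚ) (+-mono-≤-< 0≤x 0<ε)

    above : 1ℚ < (x + ε) * (x + ε) + (x + ε)
    above = begin-strict
      1ℚ                              <⟨ lower ⟩
      x * x + x + ε                   ≤⟨ p≤p+q (x * x + x + ε) (0≤* 0≤ε (0≤+ (0≤+ 0≤x 0≤x) 0≤ε)) ⟩
      x * x + x + ε + ε * (x + x + ε) ≡⟨ solve 2 (λ x ε → x :* x :+ x :+ ε :+ ε :* (x :+ x :+ ε)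
                                                   := (x :+ ε) :* (x :+ ε) :+ (x :+ ε)) refl x ε ⟩
      (x + ε) * (x + ε) + (x + ε) ∎

  module _ {a d c₁ c₂ : ℕ} (identity : a ℕ.* a ℕ.+ a ℕ.* suc d ℕ.+ c₁ ≡ suc d ℕ.* suc d ℕ.+ c₂) where

    private
      X : ℚᵘ
      X = mkℚᵘ (+ a) d

      δ : ℕ → ℚᵘ
      δ c = + c ℚᵘ./ (suc d ℕ.* suc d)

      identityℤ : + a ℤ.* + a ℤ.+ + a ℤ.* + suc d ℤ.+ + c₁ ≡ + suc d ℤ.* + suc d ℤ.+ + c₂
      identityℤ = begin
        + a ℤ.* + a ℤ.+ + a ℤ.* + suc d ℤ.+ + c₁
          ≡⟨ cong (ℤ._+ + c₁) (cong₂ ℤ._+_ (ℤ.pos-* a a) (ℤ.pos-* a (suc d))) ⟨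
        + (a ℕ.* a ℕ.+ a ℕ.* suc d ℕ.+ c₁)
          ≡⟨ cong +_ identity ⟩
        + (suc d ℕ.* suc d ℕ.+ c₂)
          ≡⟨ cong (ℤ._+ + c₂) (ℤ.pos-* (suc d) (suc d)) ⟩
        + suc d ℤ.* + suc d ℤ.+ + c₂ ∎
        where open ≡-Reasoning

    fraction-identity : X ℚᵘ.* X ℚᵘ.+ X ℚᵘ.+ δ c₁ ≃ ℚᵘ.1ℚᵘ ℚᵘ.+ δ c₂
    fraction-identity = *≡* (begin
      _                                               ≡⟨ expand (+ a) B (+ c₁) ⟩
      B⁵ ℤ.* (+ a ℤ.* + a ℤ.+ + a ℤ.* B ℤ.+ + c₁)    ≡⟨ cong (B⁵ ℤ.*_) identityℤ ⟩
      B⁵ ℤ.* (B ℤ.* B ℤ.+ + c₂)                       ≡⟨ collect B (+ c₂) ⟩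
      _                                               ∎)
      where
      open ≡-Reasoning
      B = + suc d
      B⁵ = B ℤ.* B ℤ.* B ℤ.* (B ℤ.* B)
      expand : ∀ A B C →
        ((A ℤ.* A ℤ.* B ℤ.+ A ℤ.* (B ℤ.* B)) ℤ.* (B ℤ.* B) ℤ.+ C ℤ.* (B ℤ.* B ℤ.* B)) ℤ.* (ℤ.1ℤ ℤ.* (B ℤ.* B))
          ≡ B ℤ.* B ℤ.* B ℤ.* (B ℤ.* B) ℤ.* (A ℤ.* A ℤ.+ A ℤ.* B ℤ.+ C)
      expand = ℤ-solve-∀
      collect : ∀ B C → B ℤ.* B ℤ.* B ℤ.* (B ℤ.* B) ℤ.* (B ℤ.* B ℤ.+ C)
                      ≡ (ℤ.1ℤ ℤ.* (B ℤ.* B) ℤ.+ C ℤ.* ℤ.1ℤ) ℤ.* (B ℤ.* B ℤ.* B ℤ.* (B ℤ.* B))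
      collect = ℤ-solve-∀

    δ<ε : ∀ c p q → c ℕ.* suc q ℕ.< suc d → δ c ℚᵘ.< mkℚᵘ +[1+ p ] q
    δ<ε c p q c<b = *<* (subst₂ ℤ._<_ (ℤ.pos-* c (suc q)) (ℤ.pos-* (suc p) (suc d ℕ.* suc d)) (ℤ.+<+ c<b²))
      where
      c<b² : c ℕ.* suc q ℕ.< suc p ℕ.* (suc d ℕ.* suc d)
      c<b² = ℕ.≤-trans c<b (ℕ.≤-trans (ℕ.m≤m*n (suc d) (suc d)) (ℕ.m≤n*m (suc d ℕ.* suc d) (suc p)))

    nearGolden-frac : ∀ p q .{coprime : Coprime (suc p) (suc q)} →
      c₁ ℕ.* suc q ℕ.< suc d → c₂ ℕ.* suc q ℕ.< suc d → NearGolden (mkℚ +[1+ p ] q coprime) (frac a (suc d))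
    nearGolden-frac p q {coprime} c₁<b c₂<b = toℚᵘ-cancel-< upper , toℚᵘ-cancel-< lower
      where
      open ℚᵘ.≤-Reasoning
      x = frac a (suc d)
      ε = mkℚ +[1+ p ] q coprime
      E = mkℚᵘ +[1+ p ] q
      x≃X : toℚᵘ x ≃ X
      x≃X = toℚᵘ-fromℚᵘ X
      x²+x≃X²+X : toℚᵘ (x * x + x) ≃ X ℚᵘ.* X ℚᵘ.+ X
      x²+x≃X²+X = ℚᵘ.≃-trans (toℚᵘ-homo-+ (x * x) x)
                             (ℚᵘ.+-cong (ℚᵘ.≃-trans (toℚᵘ-homo-* x x) (ℚᵘ.*-cong x≃X x≃X)) x≃X)
      upper : toℚᵘ (x * x + x) ℚᵘ.< toℚᵘ (1ℚ + ε)
      upper = begin-strict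
        toℚᵘ (x * x + x)              ≃⟨ x²+x≃X²+X ⟩
        X ℚᵘ.* X ℚᵘ.+ X               ≤⟨ ℚᵘ.p≤p+q (X ℚᵘ.* X ℚᵘ.+ X) (δ c₁) ⟩
        X ℚᵘ.* X ℚᵘ.+ X ℚᵘ.+ δ c₁     ≃⟨ fraction-identity ⟩
        ℚᵘ.1ℚᵘ ℚᵘ.+ δ c₂              <⟨ ℚᵘ.+-monoʳ-< ℚᵘ.1ℚᵘ (δ<ε c₂ p q c₂<b) ⟩
        ℚᵘ.1ℚᵘ ℚᵘ.+ E                 ≃⟨ toℚᵘ-homo-+ 1ℚ ε ⟨
        toℚᵘ (1ℚ + ε) ∎
      lower : toℚᵘ 1ℚ ℚᵘ.< toℚᵘ (x * x + x + ε)
      lower = begin-strict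
        ℚᵘ.1ℚᵘ                        ≤⟨ ℚᵘ.p≤p+q ℚᵘ.1ℚᵘ (δ c₂) ⟩
        ℚᵘ.1ℚᵘ ℚᵘ.+ δ c₂              ≃⟨ fraction-identity ⟨
        X ℚᵘ.* X ℚᵘ.+ X ℚᵘ.+ δ c₁     <⟨ ℚᵘ.+-monoʳ-< (X ℚᵘ.* X ℚᵘ.+ X) (δ<ε c₁ p q c₁<b) ⟩
        X ℚᵘ.* X ℚᵘ.+ X ℚᵘ.+ E        ≃⟨ ℚᵘ.+-cong x²+x≃X²+X ℚᵘ.≃-refl ⟨
        toℚᵘ (x * x + x) ℚᵘ.+ E       ≃⟨ toℚᵘ-homo-+ (x * x + x) ε ⟨
        toℚᵘ (x * x + x + ε) ∎

  frac-nonNegative : ∀ a b → 0ℚ ≤ frac a b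
  frac-nonNegative a zero    = ≤-refl
  frac-nonNegative a (suc d) = nonNegative⁻¹ (frac a (suc d)) {{normalize-nonNeg a (suc d)}}

  LimIsInvφ-ratio : (a b : ℕ → ℕ) (c₁ c₂ : ℕ) →
    (∀ n → a n ℕ.* a n ℕ.+ a n ℕ.* b n ℕ.+ c₁ ≡ b n ℕ.* b n ℕ.+ c₂) → (∀ n → n ℕ.< b n) →
    LimIsInvφ (λ n → frac (a n) (b n))
  -- Beyond N = (c₁ + c₂)(q + 1) every cᵢ / b² is below 1 / (q + 1) ≤ ε.
  LimIsInvφ-ratio a b c₁ c₂ identity growth ε@(mkℚ +[1+ p ] q coprime) 0<ε = (c₁ ℕ.+ c₂) ℕ.* suc q , close
    where
    close : ∀ n → (c₁ ℕ.+ c₂) ℕ.* suc q ℕ.≤ n →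
      ((frac (a n) (b n) - ε) <φ⁻¹) × (φ⁻¹< (frac (a n) (b n) + ε))
    close n N≤n with b n | growth n | identity n
    ... | suc d | ℕ.s≤s n≤d | identityₙ =
      nearGolden-bracket 0<ε (frac-nonNegative (a n) (suc d))
        (nearGolden-frac {a n} {d} {c₁} {c₂} identityₙ p q {coprime} c₁<b c₂<b)
      where
      c₁<b : c₁ ℕ.* suc q ℕ.< suc d
      c₁<b = ℕ.s≤s (ℕ.≤-trans (ℕ.*-monoˡ-≤ (suc q) (ℕ.m≤m+n c₁ c₂)) (ℕ.≤-trans N≤n n≤d))
      c₂<b : c₂ ℕ.* suc q ℕ.< suc d
      c₂<b = ℕ.s≤s (ℕ.≤-trans (ℕ.*-monoˡ-≤ (suc q) (ℕ.m≤n+m c₂ c₁)) (ℕ.≤-trans N≤n n≤d))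
  LimIsInvφ-ratio a b c₁ c₂ identity growth (mkℚ (+ 0) q _) (ℚ.*<* (ℤ.+<+ ()))
  LimIsInvφ-ratio a b c₁ c₂ identity growth (mkℚ -[1+ k ] q _) (ℚ.*<* ())

  frac-complement : ∀ {a c b} → 0 ℕ.< b → a ℕ.+ c ≡ b → frac a b + frac c b ≡ 1ℚ
  frac-complement {a} {c} {suc d} _ a+c≡b = toℚᵘ-injective (begin
    toℚᵘ (x + y)
      ≈⟨ toℚᵘ-homo-+ x y ⟩
    toℚᵘ x ℚᵘ.+ toℚᵘ y
      ≈⟨ ℚᵘ.+-cong (toℚᵘ-fromℚᵘ (mkℚᵘ (+ a) d)) (toℚᵘ-fromℚᵘ (mkℚᵘ (+ c) d)) ⟩
    mkℚᵘ (+ a) d ℚᵘ.+ mkℚᵘ (+ c) d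
      ≈⟨ *≡* (trans (factor (+ a) (+ c) B) (trans (cong (λ s → + s ℤ.* B) a+c≡b) (sym (ℤ.*-identityˡ (B ℤ.* B))))) ⟩
    ℚᵘ.1ℚᵘ ∎)
    where
    open import Relation.Binary.Reasoning.Setoid ℚᵘ.≃-setoid
    x = frac a (suc d)
    y = frac c (suc d)
    B = + suc d
    factor : ∀ A C B → (A ℤ.* B ℤ.+ C ℤ.* B) ℤ.* ℤ.1ℤ ≡ (A ℤ.+ C) ℤ.* B
    factor = ℤ-solve-∀

  LimIsInvφ⇒LimIsOneMinusInvφ : (r s : ℕ → ℚ) → (∀ n → r n + s n ≡ 1ℚ) →
    LimIsInvφ s → LimIsOneMinusInvφ r
  LimIsInvφ⇒LimIsOneMinusInvφ r s r+s≡1 lim ε 0<ε with lim ε 0<ε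
  ... | N , close = N , λ n N≤n → let below , above = close n N≤n in
      subst φ⁻¹<_ (trans (plus (r n) (s n) ε) (cong (_- (r n - ε)) (r+s≡1 n))) above
    , subst _<φ⁻¹ (trans (minus (r n) (s n) ε) (cong (_- (r n + ε)) (r+s≡1 n))) below
    where
    open +-*-Solver
    plus : ∀ r s ε → s + ε ≡ (r + s) - (r - ε)
    plus = solve 3 (λ r s ε → s :+ ε := (r :+ s) :- (r :- ε)) refl
    minus : ∀ r s ε → s - ε ≡ (r + s) - (r + ε)
    minus = solve 3 (λ r s ε → s :- ε := (r :+ s) :- (r :+ ε)) refl

  LimIsOneMinusInvφ-ratio : (a c b : ℕ → ℕ) → (∀ n → 0 ℕ.< b n) → (∀ n → a n ℕ.+ c n ≡ b n) →
    LimIsInvφ (λ n → frac (c n) (b n)) → LimIsOneMinusInvφ (λ n → frac (a n) (b n))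
  LimIsOneMinusInvφ-ratio a c b positive a+c≡b =
    LimIsInvφ⇒LimIsOneMinusInvφ (λ n → frac (a n) (b n)) (λ n → frac (c n) (b n))
      λ n → frac-complement (positive n) (a+c≡b n)

open RootedForests using (path-identity; path-growth; T-identity; T-growth; T-positive; T-centre+end)
open GoldenRatio using (LimIsInvφ-ratio; LimIsOneMinusInvφ-ratio)

proposition1 : LimIsInvφ (λ n → frac (fii (pathEdges (suc n)) zero) (f (pathEdges (suc n))))
    × (LimIsInvφ (λ k → frac (fii (TEdges k) (fromℕ (suc (suc k)))) (f (TEdges k)))
    × LimIsOneMinusInvφ (λ k → frac (fii (TEdges k) (suc (suc zero))) (f (TEdges k))))
proposition1 =
    LimIsInvφ-ratio _ _ 0 1 path-identity path-growth
  , endRatio-limit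
  , LimIsOneMinusInvφ-ratio _ _ _ T-positive T-centre+end endRatio-limit
  where
  endRatio-limit = LimIsInvφ-ratio _ _ 16 0 T-identity T-growth
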